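{- Let $R$ be an SMLL net. If $R$ contains a ready cut, then $R$ is not in normal form for $\to$.
   Context: SMLL formulas: $A ::= 1 \mid \bot \mid X \mid X^\bot \mid A\otimes A \mid A ⅋ A$ (⅋ is "par"), involutive negation with $1^\bot=\bot$, $(A\otimes B)^\bot=A^\bot ⅋ B^\bot$. Positive formulas $P ::= 1 \mid P\otimes P$; negative $N ::= \bot \mid N ⅋ N$. Nets are built from axiom, cut, $\otimes$, ⅋, one, bot links (each bot link with a box of conclusions $\bot,\Gamma$ containing a net of conclusions $\Gamma$) and $n$-ary sync links whose $i$-th premiss and $i$-th conclusion share a positive or negative type, subject to the correctness criterion (no cyclic switching path at depth 0, recursively in boxes; a switching path uses at most one premiss of each ⅋ and at most one out-edge — positive conclusion or negative premiss — of each sync link). A sync path is a path traversing only sync links, entering and exiting on corresponding edges; an edge $e$ is a hereditary conclusion of a link $l$ if there is a sync path from the conclusion of $l$ to $e$. A cut at depth 0 is ready if neither of its premisses is a hereditary conclusion of a box (i.e. above each premiss there is an axiom, one, $\otimes$ or ⅋ link not inside a box). Reduction $\to$ (at depth 0): axiom/cut, $\otimes$/⅋ cut, pushing a sync link above a $\otimes$ or ⅋ link, moving a sync from the positive conclusion $P$ of an axiom to its other conclusion $P^\bot$, moving a sync from the premiss $P^\bot$ of a cut to its other premiss $P$, erasing a sync whose premisses all come from one links, and opening a box cut against a one link. -}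

module Defs where

open import Data.Nat using (ℕ; zero; suc; _≤_)
open import Data.Fin using (Fin; zero; suc; inject₁; fromℕ)
open import Data.Product using (Σ; ∃; ∃-syntax; _×_; _,_)
open import Data.Sum using (_⊎_; inj₁; inj₂)
open import Data.Empty using (⊥)
open import Relation.Nullary using (¬_)
open import Relation.Binary.PropositionalEquality using (_≡_; _≢_)
open import Function.Definitions using (Injective)

data Formula : Set where
  one  : Formula
  bot  : Formula
  var  : ℕ → Formula
  nvar : ℕ → Formula
  _⊗_  : Formula → Formula → Formula
  _⅋_  : Formula → Formula → Formula

_ᗮ : Formula → Formula
one ᗮ      = bot
bot ᗮ      = one
var x ᗮ    = nvar x
nvar x ᗮ   = var x
(A ⊗ B) ᗮ  = (A ᗮ) ⅋ (B ᗮ)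
(A ⅋ B) ᗮ  = (A ᗮ) ⊗ (B ᗮ)

data Pos : Formula → Set where
  one : Pos one
  _⊗_ : ∀ {A B} → Pos A → Pos B → Pos (A ⊗ B)

data Neg : Formula → Set where
  bot : Neg bot
  _⅋_ : ∀ {A B} → Neg A → Neg B → Neg (A ⅋ B)

-- Proof structures.  A net (at one depth) has E edges, typed by
-- ty : Fin E → Formula, and L links  lk : Fin L → Link E.
-- Edges are referred to by their index in Fin E.

data Link (E : ℕ) : Set where
  ax   : (a b : Fin E) → Link E
  cut  : (a b : Fin E) → Link E
  -- ⊗ / ⅋ link with premisses a , b and conclusion c
  tens : (a b c : Fin E) → Link E
  par  : (a b c : Fin E) → Link E
  one  : (c : Fin E) → Link E
  -- n-ary sync link: i-th premiss p i, i-th conclusion c i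
  sync : (n : ℕ) → (p c : Fin n → Fin E) → Link E
  -- bot link with its box: conclusions  b : ⊥  and  g : Fin k → Fin E  (the context Γ);
  -- the box contains a net with E' edges typed by ty', L' links lk',
  -- whose conclusions are listed (bijectively) by h : Fin k → Fin E',
  -- the j-th inner conclusion h j corresponding to the outer edge g j.
  box  : (b : Fin E) (k : ℕ) (g : Fin k → Fin E)
         (E' L' : ℕ) (ty' : Fin E' → Formula) (lk' : Fin L' → Link E')
         (h : Fin k → Fin E') → Link E

module _ {E : ℕ} where

  data IsConcl : Link E → Fin E → Set where
    ax₁   : ∀ {a b} → IsConcl (ax a b) a
    ax₂   : ∀ {a b} → IsConcl (ax a b) b
    tens  : ∀ {a b c} → IsConcl (tens a b c) c
    par   : ∀ {a b c} → IsConcl (par a b c) c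
    one   : ∀ {c} → IsConcl (one c) c
    sync  : ∀ {n p c} (j : Fin n) → IsConcl (sync n p c) (c j)
    boxb  : ∀ {b k g E' L' ty' lk' h} → IsConcl (box b k g E' L' ty' lk' h) b
    boxΓ  : ∀ {b k g E' L' ty' lk' h} (j : Fin k) → IsConcl (box b k g E' L' ty' lk' h) (g j)

  data IsPrem : Link E → Fin E → Set where
    cut₁  : ∀ {a b} → IsPrem (cut a b) a
    cut₂  : ∀ {a b} → IsPrem (cut a b) b
    tens₁ : ∀ {a b c} → IsPrem (tens a b c) a
    tens₂ : ∀ {a b c} → IsPrem (tens a b c) b
    par₁  : ∀ {a b c} → IsPrem (par a b c) a
    par₂  : ∀ {a b c} → IsPrem (par a b c) b
    sync  : ∀ {n p c} (j : Fin n) → IsPrem (sync n p c) (p j)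

  data IsParPrem : Link E → Fin E → Set where
    par₁  : ∀ {a b c} → IsParPrem (par a b c) a
    par₂  : ∀ {a b c} → IsParPrem (par a b c) b

  data IsSyncOut (ty : Fin E → Formula) : Link E → Fin E → Set where
    posConcl : ∀ {n p c} (j : Fin n) → Pos (ty (c j)) → IsSyncOut ty (sync n p c) (c j)
    negPrem  : ∀ {n p c} (j : Fin n) → Neg (ty (p j)) → IsSyncOut ty (sync n p c) (p j)

  data IsBox : Link E → Set where
    isBox : ∀ {b k g E' L' ty' lk' h} → IsBox (box b k g E' L' ty' lk' h)

  data IsBoxBot : Link E → Fin E → Set where
    isBoxBot : ∀ {b k g E' L' ty' lk' h} → IsBoxBot (box b k g E' L' ty' lk' h) b

  data IsAx : Link E → Set where
    isAx : ∀ {a b} → IsAx (ax a b)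

-- Conditions on a single depth (boxes are treated as generalized links
-- with conclusions ⊥, Γ).

module Level {E L : ℕ} (ty : Fin E → Formula) (lk : Fin L → Link E) where

  LinkTyped : Link E → Set
  LinkTyped (ax a b)     = a ≢ b × ty b ≡ ty a ᗮ
  LinkTyped (cut a b)    = a ≢ b × ty b ≡ ty a ᗮ
  LinkTyped (tens a b c) = a ≢ b × ty c ≡ ty a ⊗ ty b
  LinkTyped (par a b c)  = a ≢ b × ty c ≡ ty a ⅋ ty b
  LinkTyped (one c)      = ty c ≡ one
  LinkTyped (sync n p c) =
    1 ≤ n × Injective _≡_ _≡_ p × Injective _≡_ _≡_ c ×
    (∀ j → ty (p j) ≡ ty (c j) × (Pos (ty (p j)) ⊎ Neg (ty (p j))))
  LinkTyped (box b k g E' L' ty' lk' h) =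
    ty b ≡ bot × Injective _≡_ _≡_ g × (∀ j → g j ≢ b) ×
    Injective _≡_ _≡_ h ×
    (∀ j (l : Fin L') → ¬ IsPrem (lk' l) (h j)) ×
    (∀ (e : Fin E') → (∀ (l : Fin L') → ¬ IsPrem (lk' l) e) → ∃[ j ] h j ≡ e) ×
    (∀ j → ty' (h j) ≡ ty (g j))

  Structured : Set
  Structured =
    (∀ e → ∃[ l ] IsConcl (lk l) e) ×
    (∀ e l l' → IsConcl (lk l) e → IsConcl (lk l') e → l ≡ l') ×
    (∀ e l l' → IsPrem (lk l) e → IsPrem (lk l') e → l ≡ l')

  Joins : Fin E → Fin L → Fin L → Set
  Joins e l l' = (IsConcl (lk l) e × IsPrem (lk l') e) ⊎ (IsPrem (lk l) e × IsConcl (lk l') e)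

  record SwitchingCycle : Set where
    field
      n       : ℕ
      v       : Fin (suc (suc n)) → Fin L
      w       : Fin (suc n) → Fin E
      closed  : v zero ≡ v (fromℕ (suc n))
      joins   : ∀ i → Joins (w i) (v (inject₁ i)) (v (suc i))
      edgesDistinct : Injective _≡_ _≡_ w
      parOnce  : ∀ l i j → IsParPrem (lk l) (w i) → IsParPrem (lk l) (w j) → i ≡ j
      syncOnce : ∀ l i j → IsSyncOut ty (lk l) (w i) → IsSyncOut ty (lk l) (w j) → i ≡ j

  LevelOK : Set
  LevelOK = Structured × (∀ l → LinkTyped (lk l)) × ¬ SwitchingCycle

mutual
  data NetOK {E L : ℕ} (ty : Fin E → Formula) (lk : Fin L → Link E) : Set where
    netOK : Level.LevelOK ty lk → (∀ l → InnerOK (lk l)) → NetOK ty lk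

  data InnerOK {E : ℕ} : Link E → Set where
    axOK   : ∀ {a b} → InnerOK (ax a b)
    cutOK  : ∀ {a b} → InnerOK (cut a b)
    tensOK : ∀ {a b c} → InnerOK (tens a b c)
    parOK  : ∀ {a b c} → InnerOK (par a b c)
    oneOK  : ∀ {c} → InnerOK (one c)
    syncOK : ∀ {n p c} → InnerOK (sync n p c)
    boxOK  : ∀ {b k g E' L' ty' lk' h} → NetOK ty' lk' → InnerOK (box b k g E' L' ty' lk' h)

record Net : Set where
  field
    E  : ℕ
    L  : ℕ
    ty : Fin E → Formula
    lk : Fin L → Link E

SMLLNet : Net → Set
SMLLNet R = NetOK (Net.ty R) (Net.lk R)

module _ (R : Net) where
  open Net R

  data HerConc (l : Fin L) : Fin E → Set where
    base : ∀ {e} → IsConcl (lk l) e → HerConc l e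
    step : ∀ {s n p c j} → HerConc l (p j) → lk s ≡ sync n p c → HerConc l (c j)

  ReadyCut : Fin L → Set
  ReadyCut k = Σ (Fin E) λ a → Σ (Fin E) λ b → lk k ≡ cut a b ×
    ((l : Fin L) → IsBox (lk l) → ¬ HerConc l a × ¬ HerConc l b)

  -- left-hand sides of the reduction rules of → (at depth 0)
  data Redex : Set where
    axCut : ∀ k a b l → lk k ≡ cut a b → IsAx (lk l) →
            (IsConcl (lk l) a ⊎ IsConcl (lk l) b) → Redex
    tensPar : ∀ k a b l l' a₁ a₂ b₁ b₂ → lk k ≡ cut a b →
            ((lk l ≡ tens a₁ a₂ a × lk l' ≡ par b₁ b₂ b) ⊎
             (lk l ≡ par a₁ a₂ a × lk l' ≡ tens b₁ b₂ b)) → Redex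
    -- pushing a sync link above a ⊗ or ⅋ link
    syncPush : ∀ s n p c (j : Fin n) l x y → lk s ≡ sync n p c →
            (lk l ≡ tens x y (p j) ⊎ lk l ≡ par x y (p j)) → Redex
    -- moving a sync from the positive conclusion of an axiom to its other conclusion
    syncAx : ∀ s n p c (j : Fin n) l → lk s ≡ sync n p c → IsAx (lk l) →
            IsConcl (lk l) (p j) → Pos (ty (p j)) → Redex
    -- moving a sync from the (negative) premiss P^⊥ of a cut to its other premiss P
    syncCut : ∀ s n p c (j : Fin n) k → lk s ≡ sync n p c → IsPrem (lk k) (c j) →
            (∃[ a ] ∃[ b ] lk k ≡ cut a b) → Neg (ty (c j)) → Redex
    -- erasing a sync whose premisses all come from one links
    syncOne : ∀ s n p c → lk s ≡ sync n p c →
            (∀ (j : Fin n) → ∃[ l ] lk l ≡ one (p j)) → Redex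
    -- opening a box cut against a one link
    boxOne : ∀ k a b l l' → lk k ≡ cut a b →
            ((IsBoxBot (lk l) a × lk l' ≡ one b) ⊎ (IsBoxBot (lk l) b × lk l' ≡ one a)) →
            Redex

  NormalForm : Set
  NormalForm = ¬ Redex

{-# OPTIONS --safe #-}
module Submission where

-- Look at the link above each premiss of the ready cut. An axiom gives an axiom/cut redex,
-- a box is excluded by readiness, and a sync link with a negative conclusion can be moved
-- across the cut. Above a positive, non-unit conclusion of a sync link, climb the sync
-- path: it must end at an axiom, ⊗ or ⅋ link, where a sync rule fires (a one link is
-- excluded by the type, a box by readiness), and it does end, since each of its edges lies
-- at a unique distance from the cut and so no edge is visited twice. Otherwise both
-- premisses come from ⊗/⅋ links or have type 1, and duality of their types leaves only the
-- ⊗/⅋ redex.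

open import Defs
open import Data.Nat using (ℕ; zero; suc; _+_; _∸_)
open import Data.Nat.Properties using (+-suc; +-identityʳ; m∸n+n≡m; <-irrefl)
open import Data.Fin using (Fin; toℕ)
open import Data.Fin.Properties using (toℕ-injective; toℕ≤pred[n]; injective⇒≤)
open import Data.Product using (∃; ∃-syntax; _×_; _,_; proj₁; proj₂)
open import Data.Sum using (_⊎_; inj₁; inj₂)
open import Data.Empty using (⊥-elim)
open import Relation.Nullary using (¬_)
open import Relation.Binary.PropositionalEquality
  using (_≡_; _≢_; refl; sym; trans; cong; subst)

Pos⇒≡one⊎≢one : ∀ {A} → Pos A → A ≡ one ⊎ A ≢ one
Pos⇒≡one⊎≢one one     = inj₁ refl
Pos⇒≡one⊎≢one (_ ⊗ _) = inj₂ λ ()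

module _ {n : ℕ} (Rank : ℕ → Fin n → Set)
         (Rank-unique : ∀ {i j x} → Rank i x → Rank j x → i ≡ j)
         (Rank-pred : ∀ {i x} → Rank (suc i) x → ∃ (Rank i)) where

  private
    descend : ∀ d {i x} → Rank (d + i) x → ∃ (Rank i)
    descend zero    r = _ , r
    descend (suc d) r = descend d (proj₂ (Rank-pred r))

  -- Elements of ranks 0, 1, …, n would be n + 1 distinct elements of Fin n.
  Rank-bounded : ∀ {x} → ¬ Rank n x
  Rank-bounded {x} r = <-irrefl refl (injective⇒≤ {f = witness} witness-injective)
    where
      below : (i : Fin (suc n)) → ∃ (Rank (toℕ i))
      below i = descend (n ∸ toℕ i)
                  (subst (λ m → Rank m x) (sym (m∸n+n≡m (toℕ≤pred[n] i))) r)

      witness : Fin (suc n) → Fin n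
      witness i = proj₁ (below i)

      witness-injective : ∀ {i j} → witness i ≡ witness j → i ≡ j
      witness-injective {i} {j} eq = toℕ-injective
        (Rank-unique (proj₂ (below i)) (subst (Rank _) (sym eq) (proj₂ (below j))))

module Reduction (R : Net)
  (structured : Level.Structured (Net.ty R) (Net.lk R))
  (typed : ∀ l → Level.LinkTyped (Net.ty R) (Net.lk R) (Net.lk R l)) where
  open Net R
  open Level ty lk using (LinkTyped)

  data Source (e : Fin E) : Set where
    axiom  : ∀ l → IsAx (lk l) → IsConcl (lk l) e → Source e
    tensor : ∀ l x y → lk l ≡ tens x y e → ty e ≡ ty x ⊗ ty y → Source e
    par    : ∀ l x y → lk l ≡ par x y e → ty e ≡ ty x ⅋ ty y → Source e
    one    : ∀ l → lk l ≡ one e → ty e ≡ one → Source e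
    box    : ∀ l → IsBox (lk l) → IsConcl (lk l) e → Source e
    sync   : ∀ s n p c j → lk s ≡ sync n p c → e ≡ c j →
             Pos (ty e) ⊎ Neg (ty e) → Source e

  concl-along : ∀ {l lnk e} → lk l ≡ lnk → IsConcl lnk e → IsConcl (lk l) e
  concl-along eq = subst (λ z → IsConcl z _) (sym eq)

  classify : ∀ {e} l {lnk} → lk l ≡ lnk → LinkTyped lnk → IsConcl lnk e → Source e
  classify l eq _ ax₁        = axiom l (subst IsAx (sym eq) isAx) (concl-along eq ax₁)
  classify l eq _ ax₂        = axiom l (subst IsAx (sym eq) isAx) (concl-along eq ax₂)
  classify l eq (_ , t) tens = tensor l _ _ eq t
  classify l eq (_ , t) par  = par l _ _ eq t
  classify l eq t one        = one l eq t
  classify l eq _ boxb       = box l (subst IsBox (sym eq) isBox) (concl-along eq boxb)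
  classify l eq _ (boxΓ j)   = box l (subst IsBox (sym eq) isBox) (concl-along eq (boxΓ j))
  classify l {sync n p c} eq (_ , _ , _ , t) (sync j) =
    sync l n p c j eq refl (subst (λ A → Pos A ⊎ Neg A) (proj₁ (t j)) (proj₂ (t j)))

  source : ∀ e → Source e
  source e = let l , concl = proj₁ structured e in classify l refl (typed l) concl

  premiss-unique : ∀ {e l l'} → IsPrem (lk l) e → IsPrem (lk l') e → l ≡ l'
  premiss-unique = proj₂ (proj₂ structured) _ _ _

  sync-premiss : ∀ {s n p c} j → lk s ≡ sync n p c → IsPrem (lk s) (p j)
  sync-premiss j eq = subst (λ z → IsPrem z _) (sym eq) (sync j)

  sync-type : ∀ {s n p c} j → lk s ≡ sync n p c → ty (p j) ≡ ty (c j)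
  sync-type {s} j eq = let _ , _ , _ , t = subst LinkTyped eq (typed s) in proj₁ (t j)

  sync-step-unique : ∀ {s s' n n' p c p' c'} {j : Fin n} {j' : Fin n'} →
                     lk s ≡ sync n p c → lk s' ≡ sync n' p' c' → p j ≡ p' j' → c j ≡ c' j'
  sync-step-unique {s} {j = j} {j'} eq eq' pj≡p'j'
    with refl ← premiss-unique (sync-premiss j eq)
                  (subst (IsPrem _) (sym pj≡p'j') (sync-premiss j' eq'))
    with refl ← trans (sym eq) eq'
    = let _ , p-injective , _ = subst LinkTyped eq (typed s)
      in cong _ (p-injective pj≡p'j')

  cut-premiss-not-sync-premiss : ∀ {k a b e} → lk k ≡ cut a b → IsPrem (lk k) e →
                                 ∀ {s n p c} j → lk s ≡ sync n p c → p j ≢ e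
  cut-premiss-not-sync-premiss cut≡ prem j eq refl
    with refl ← premiss-unique (sync-premiss j eq) prem
    with () ← trans (sym eq) cut≡

  module Climb (e₀ : Fin E)
    (e₀-not-sync-premiss : ∀ {s n p c} j → lk s ≡ sync n p c → p j ≢ e₀)
    (e₀-pos : Pos (ty e₀)) (e₀-≢one : ty e₀ ≢ one)
    (e₀-not-boxed : ∀ l → IsBox (lk l) → ¬ HerConc R l e₀) where

    data Above : ℕ → Fin E → Set where
      here : Above 0 e₀
      up   : ∀ {m x s n p c} j → lk s ≡ sync n p c → x ≡ p j → Above m (c j) → Above (suc m) x

    Above-unique : ∀ {i j x} → Above i x → Above j x → i ≡ j
    Above-unique here           here             = refl
    Above-unique here           (up j eq x≡ _)   = ⊥-elim (e₀-not-sync-premiss j eq (sym x≡))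
    Above-unique (up j eq x≡ _) here             = ⊥-elim (e₀-not-sync-premiss j eq (sym x≡))
    Above-unique (up _ eq x≡ a) (up _ eq' x≡′ a') = cong suc (Above-unique a a″)
      where a″ = subst (Above _) (sym (sync-step-unique eq eq' (trans (sym x≡) x≡′))) a'

    Above-pred : ∀ {m x} → Above (suc m) x → ∃ (Above m)
    Above-pred (up _ _ _ a) = _ , a

    Above-type : ∀ {m x} → Above m x → ty x ≡ ty e₀
    Above-type here             = refl
    Above-type (up j eq refl a) = trans (sync-type j eq) (Above-type a)

    Above-herConc : ∀ {l m x} → Above m x → HerConc R l x → HerConc R l e₀
    Above-herConc here             h = h
    Above-herConc (up j eq refl a) h = Above-herConc a (step {j = j} h eq)

    climb-step : ∀ {m x} → Above (suc m) x → Redex R ⊎ ∃ (Above (suc (suc m)))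
    climb-step a@(up {s = s} {n} {p} {c} j eq refl _) with source (p j)
    ... | axiom l isax concl =
          inj₁ (syncAx s n p c j l eq isax concl (subst Pos (sym (Above-type a)) e₀-pos))
    ... | tensor l x y eql _ = inj₁ (syncPush s n p c j l x y eq (inj₁ eql))
    ... | par l x y eql _    = inj₁ (syncPush s n p c j l x y eq (inj₂ eql))
    ... | one _ _ t          = ⊥-elim (e₀-≢one (trans (sym (Above-type a)) t))
    ... | box l isbox concl  = ⊥-elim (e₀-not-boxed l isbox (Above-herConc a (base concl)))
    ... | sync _ _ _ _ j' eq' x≡ _ = inj₂ (_ , up j' eq' refl (subst (Above _) x≡ a))

    climb-fuel : ∀ f {m x} → f + m ≡ E → Above (suc m) x → Redex R
    climb-fuel zero    refl a =
      ⊥-elim (Rank-bounded Above Above-unique Above-pred (proj₂ (Above-pred a)))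
    climb-fuel (suc f) f+m≡E a with climb-step a
    ... | inj₁ r        = r
    ... | inj₂ (_ , a') = climb-fuel f (trans (+-suc f _) f+m≡E) a'

    climb : ∀ {s n p c} j → lk s ≡ sync n p c → e₀ ≡ c j → Redex R
    climb j eq e₀≡ = climb-fuel E (+-identityʳ E) (up j eq refl (subst (Above 0) e₀≡ here))

  -- What remains of a cut premiss once axioms, boxes and sync links above it are dealt with.
  data Principal (e : Fin E) : Set where
    tensor : ∀ l x y → lk l ≡ tens x y e → ty e ≡ ty x ⊗ ty y → Principal e
    par    : ∀ l x y → lk l ≡ par x y e → ty e ≡ ty x ⅋ ty y → Principal e
    unit   : ty e ≡ one → Principal e

  module ReadyCutRedex (k : Fin L) (a b : Fin E) (cut≡ : lk k ≡ cut a b)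
    (ready : (l : Fin L) → IsBox (lk l) → ¬ HerConc R l a × ¬ HerConc R l b) where

    cut-premiss : ∀ {e} → e ≡ a ⊎ e ≡ b → IsPrem (lk k) e
    cut-premiss (inj₁ refl) = subst (λ z → IsPrem z a) (sym cut≡) cut₁
    cut-premiss (inj₂ refl) = subst (λ z → IsPrem z b) (sym cut≡) cut₂

    not-boxed : ∀ {e} → e ≡ a ⊎ e ≡ b → ∀ l → IsBox (lk l) → ¬ HerConc R l e
    not-boxed (inj₁ refl) l isbox = proj₁ (ready l isbox)
    not-boxed (inj₂ refl) l isbox = proj₂ (ready l isbox)

    axiom-redex : ∀ {e l} → e ≡ a ⊎ e ≡ b → IsAx (lk l) → IsConcl (lk l) e → Redex R
    axiom-redex (inj₁ refl) isax concl = axCut k a b _ cut≡ isax (inj₁ concl)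
    axiom-redex (inj₂ refl) isax concl = axCut k a b _ cut≡ isax (inj₂ concl)

    premiss-redex : ∀ {e} → e ≡ a ⊎ e ≡ b → Redex R ⊎ Principal e
    premiss-redex {e} side with source e
    ... | axiom _ isax concl  = inj₁ (axiom-redex side isax concl)
    ... | box l isbox concl   = ⊥-elim (not-boxed side l isbox (base concl))
    ... | tensor l x y eq t   = inj₂ (tensor l x y eq t)
    ... | par l x y eq t      = inj₂ (par l x y eq t)
    ... | one _ _ t           = inj₂ (unit t)
    ... | sync s n p c j eq e≡ (inj₂ neg) =
          inj₁ (syncCut s n p c j k eq (subst (IsPrem _) e≡ (cut-premiss side)) (a , b , cut≡)
                  (subst (λ z → Neg (ty z)) e≡ neg))
    ... | sync s n p c j eq e≡ (inj₁ pos) with Pos⇒≡one⊎≢one pos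
    ...   | inj₁ t    = inj₂ (unit t)
    ...   | inj₂ ≢one =
          inj₁ (Climb.climb e (cut-premiss-not-sync-premiss cut≡ (cut-premiss side)) pos ≢one
                  (not-boxed side) j eq e≡)

    dual-of : ∀ {A B} → ty a ≡ A → ty b ≡ B → B ≡ A ᗮ
    dual-of ta tb = trans (sym tb) (trans (proj₂ (subst LinkTyped cut≡ (typed k))) (cong _ᗮ ta))

    principal-redex : Principal a → Principal b → Redex R
    principal-redex (tensor l x y eq _) (par l' x' y' eq' _) =
      tensPar k a b l l' x y x' y' cut≡ (inj₁ (eq , eq'))
    principal-redex (par l x y eq _) (tensor l' x' y' eq' _) =
      tensPar k a b l l' x y x' y' cut≡ (inj₂ (eq , eq'))
    principal-redex (tensor _ _ _ _ ta) (tensor _ _ _ _ tb) with () ← dual-of ta tb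
    principal-redex (tensor _ _ _ _ ta) (unit tb)           with () ← dual-of ta tb
    principal-redex (par _ _ _ _ ta)    (par _ _ _ _ tb)    with () ← dual-of ta tb
    principal-redex (par _ _ _ _ ta)    (unit tb)           with () ← dual-of ta tb
    principal-redex (unit ta)           (tensor _ _ _ _ tb) with () ← dual-of ta tb
    principal-redex (unit ta)           (par _ _ _ _ tb)    with () ← dual-of ta tb
    principal-redex (unit ta)           (unit tb)           with () ← dual-of ta tb

    redex : Redex R
    redex with premiss-redex (inj₁ refl) | premiss-redex (inj₂ refl)
    ... | inj₁ r  | _       = r
    ... | inj₂ _  | inj₁ r  = r
    ... | inj₂ pa | inj₂ pb = principal-redex pa pb

ReadyCut⇒Redex : (R : Net) → SMLLNet R → ∀ {k} → ReadyCut R k → Redex R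
ReadyCut⇒Redex R (netOK (structured , typed , _) _) (a , b , cut≡ , ready) =
  Reduction.ReadyCutRedex.redex R structured typed _ a b cut≡ ready

mainTheorem5 : (R : Net) → SMLLNet R → ∃[ k ] ReadyCut R k → ¬ NormalForm R
mainTheorem5 R net (_ , ready) normal = normal (ReadyCut⇒Redex R net ready)
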